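{- Every sequent $\Gamma\vdash\Delta$ that is derivable in the labelled sequent calculus $LS_{BBI}$ is valid with respect to the (non-deterministic monoidal) Kripke semantics of BBI.
   Context: BBI formulae: $A ::= p \mid \top \mid \bot \mid \neg A \mid A\lor A \mid A\land A \mid A\to A \mid \top^* \mid A * A \mid A \mathrel{ -\!*} A$, $p$ atomic; in the calculus $\neg A$ abbreviates $A\to\bot$ and $A\lor B$ abbreviates $\neg(\neg A\land\neg B)$. Semantics. A frame is $(\mathcal{M},\triangleright,\epsilon)$ with $\mathcal{M}$ nonempty, $\epsilon\in\mathcal{M}$, $\triangleright\subseteq\mathcal{M}^3$ (written $a,b\triangleright c$) such that for all $a,b,c,d$: $\epsilon,a\triangleright b$ iff $a=b$; $a,b\triangleright c$ iff $b,a\triangleright c$; if $a,k\triangleright d$ and $b,c\triangleright k$ for some $k$, then there is $l$ with $a,b\triangleright l$ and $l,c\triangleright d$. A model adds a valuation $v$ from atoms to subsets of $\mathcal{M}$. Forcing: $m\Vdash p$ iff $m\in v(p)$; $m\Vdash\top^*$ iff $m=\epsilon$; $\top$ always, $\bot$ never; $\land,\lor,\to,\neg$ classical pointwise; $m\Vdash A*B$ iff there are $a,b$ with $a,b\triangleright m$, $a\Vdash A$, $b\Vdash B$; $m\Vdash A\mathrel{ -\!*}B$ iff for all $a,b$, if $m,a\triangleright b$ and $a\Vdash A$ then $b\Vdash B$. Syntax of sequents. Labels are label variables (from an infinite set $LVar$) or the constant $\epsilon$. A labelled formula is $w:A$; a relational atom is $(x,y\triangleright z)$ for labels $x,y,z$.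 A sequent $\Gamma\vdash\Delta$ has $\Gamma$ a finite multiset of labelled formulae and relational atoms and $\Delta$ a finite multiset of labelled formulae; ";" is multiset union. $\Gamma[y/x]$ replaces every occurrence of label $x$ by $y$. A sequent is valid iff for every frame, valuation $v$ and map $\rho$ from labels to $\mathcal{M}$ with $\rho(\epsilon)=\epsilon$: if $\rho(w)\Vdash A$ for every $w:A\in\Gamma$ and $\rho(x),\rho(y)\triangleright\rho(z)$ for every $(x,y\triangleright z)\in\Gamma$, then $\rho(w)\Vdash A$ for some $w:A\in\Delta$. Rules of $LS_{BBI}$ ("from premises infer conclusion"; $P$ atomic): id: infer $\Gamma;w:P\vdash w:P;\Delta$. $\bot L$: infer $\Gamma;w:\bot\vdash\Delta$. $\top R$: infer $\Gamma\vdash w:\top;\Delta$. $\top^*R$: infer $\Gamma\vdash\epsilon:\top^*;\Delta$. cut: from $\Gamma\vdash x:A;\Delta$ and $\Gamma';x:A\vdash\Delta'$ infer $\Gamma;\Gamma'\vdash\Delta;\Delta'$. $\top^*L$: from $\Gamma[\epsilon/w]\vdash\Delta[\epsilon/w]$ infer $\Gamma;w:\top^*\vdash\Delta$ ($w\neq\epsilon$). $\land L$: from $\Gamma;w:A;w:B\vdash\Delta$ infer $\Gamma;w:A\land B\vdash\Delta$. $\land R$: from $\Gamma\vdash w:A;\Delta$ and $\Gamma\vdash w:B;\Delta$ infer $\Gamma\vdash w:A\land B;\Delta$. $\to L$: from $\Gamma\vdash w:A;\Delta$ and $\Gamma;w:B\vdash\Delta$ infer $\Gamma;w:A\to B\vdash\Delta$.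 $\to R$: from $\Gamma;w:A\vdash w:B;\Delta$ infer $\Gamma\vdash w:A\to B;\Delta$. $*L$: from $(x,y\triangleright z);\Gamma;x:A;y:B\vdash\Delta$ infer $\Gamma;z:A*B\vdash\Delta$ ($x,y$ not in the conclusion). $\mathrel{ -\!*}R$: from $(x,y\triangleright z);\Gamma;x:A\vdash z:B;\Delta$ infer $\Gamma\vdash y:A\mathrel{ -\!*}B;\Delta$ ($x,z$ not in the conclusion). $*R$: from $(x,y\triangleright z);\Gamma\vdash x:A;z:A*B;\Delta$ and $(x,y\triangleright z);\Gamma\vdash y:B;z:A*B;\Delta$ infer $(x,y\triangleright z);\Gamma\vdash z:A*B;\Delta$. $\mathrel{ -\!*}L$: from $(x,y\triangleright z);\Gamma;y:A\mathrel{ -\!*}B\vdash x:A;\Delta$ and $(x,y\triangleright z);\Gamma;y:A\mathrel{ -\!*}B;z:B\vdash\Delta$ infer $(x,y\triangleright z);\Gamma;y:A\mathrel{ -\!*}B\vdash\Delta$. E: from $(y,x\triangleright z);(x,y\triangleright z);\Gamma\vdash\Delta$ infer $(x,y\triangleright z);\Gamma\vdash\Delta$. U: from $(x,\epsilon\triangleright x);\Gamma\vdash\Delta$ infer $\Gamma\vdash\Delta$. A: from $(u,w\triangleright z);(y,v\triangleright w);(x,y\triangleright z);(u,v\triangleright x);\Gamma\vdash\Delta$ infer $(x,y\triangleright z);(u,v\triangleright x);\Gamma\vdash\Delta$ ($w$ not in the conclusion). $A_C$: from $(x,w\triangleright x);(y,y\triangleright w);(x,y\triangleright x);\Gamma\vdash\Delta$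 infer $(x,y\triangleright x);\Gamma\vdash\Delta$ ($w$ not in the conclusion). $Eq_1$: from $(\epsilon,w'\triangleright w');\Gamma[w'/w]\vdash\Delta[w'/w]$ infer $(\epsilon,w\triangleright w');\Gamma\vdash\Delta$ ($w\neq\epsilon$). $Eq_2$: from $(\epsilon,w'\triangleright w');\Gamma[w'/w]\vdash\Delta[w'/w]$ infer $(\epsilon,w'\triangleright w);\Gamma\vdash\Delta$ ($w\neq\epsilon$). -}

module Defs where

open import Level using (Level; Lift) renaming (suc to lsuc; zero to lzero)
open import Data.Nat using (ℕ)
open import Data.Nat.Properties using () renaming (_≟_ to _≟ℕ_)
open import Data.Product using (Σ; _×_; _,_)
open import Data.List using (List; []; _∷_; _++_; map; concatMap)
open import Data.List.Membership.Propositional using (_∉_)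
open import Data.List.Relation.Unary.All using (All)
open import Data.List.Relation.Unary.Any using (Any)
open import Data.List.Relation.Binary.Permutation.Propositional using (_↭_)
open import Data.Unit using (⊤)
open import Data.Empty using (⊥)
open import Relation.Binary.PropositionalEquality using (_≡_; _≢_)
open import Relation.Nullary using (yes; no)

data Formula : Set where
  atom : ℕ → Formula
  `⊤ `⊥ `⊤* : Formula
  _`∧_ _`⇒_ _`*_ _`-*_ : Formula → Formula → Formula

`¬_ : Formula → Formula
`¬ A = A `⇒ `⊥

_`∨_ : Formula → Formula → Formula
A `∨ B = `¬ ((`¬ A) `∧ (`¬ B))

data Label : Set where
  ε   : Label
  var : ℕ → Label

_≟L_ : (x y : Label) → Relation.Nullary.Dec (x ≡ y)
ε ≟L ε = yes Relation.Binary.PropositionalEquality.refl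
ε ≟L var _ = no (λ ())
var _ ≟L ε = no (λ ())
var i ≟L var j with i ≟ℕ j
... | yes Relation.Binary.PropositionalEquality.refl = yes Relation.Binary.PropositionalEquality.refl
... | no i≢j = no (λ { Relation.Binary.PropositionalEquality.refl → i≢j Relation.Binary.PropositionalEquality.refl })

data LFormula : Set where
  _∶_ : Label → Formula → LFormula

data Item : Set where
  ‵_     : LFormula → Item
  ⟨_,_▷_⟩ : Label → Label → Label → Item

infix 6 _∶_

-- Substitution [y/x] on labels
substL : Label → Label → Label → Label
substL y x l with l ≟L x
... | yes _ = y
... | no  _ = l

substLF : Label → Label → LFormula → LFormula
substLF y x (w ∶ A) = substL y x w ∶ A

substI : Label → Label → Item → Item
substI y x (‵ φ) = ‵ substLF y x φ
substI y x ⟨ a , b ▷ c ⟩ = ⟨ substL y x a , substL y x b ▷ substL y x c ⟩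

substΓ : Label → Label → List Item → List Item
substΓ y x = map (substI y x)

substΔ : Label → Label → List LFormula → List LFormula
substΔ y x = map (substLF y x)

labelsLF : LFormula → List Label
labelsLF (w ∶ _) = w ∷ []

labelsI : Item → List Label
labelsI (‵ φ) = labelsLF φ
labelsI ⟨ a , b ▷ c ⟩ = a ∷ b ∷ c ∷ []

labels : List Item → List LFormula → List Label
labels Γ Δ = concatMap labelsI Γ ++ concatMap labelsLF Δ

Fresh : Label → List Item → List LFormula → Set
Fresh l Γ Δ = l ∉ labels Γ Δ

-- The calculus LS_BBI.  Sequents are pairs of lists taken up to
-- permutation (rule `perm`), which realises the multiset reading.
-- Principal formulae are placed at the head of the lists.

infix 4 _⊢_

data _⊢_ : List Item → List LFormula → Set where
  id   : ∀ {Γ Δ w P} → (‵ (w ∶ atom P) ∷ Γ) ⊢ ((w ∶ atom P) ∷ Δ)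
  ⊥L   : ∀ {Γ Δ w} → (‵ (w ∶ `⊥) ∷ Γ) ⊢ Δ
  ⊤R   : ∀ {Γ Δ w} → Γ ⊢ ((w ∶ `⊤) ∷ Δ)
  ⊤*R  : ∀ {Γ Δ} → Γ ⊢ ((ε ∶ `⊤*) ∷ Δ)
  cut  : ∀ {Γ Δ Γ' Δ' x A} →
         Γ ⊢ ((x ∶ A) ∷ Δ) → (‵ (x ∶ A) ∷ Γ') ⊢ Δ' → (Γ ++ Γ') ⊢ (Δ ++ Δ')
  ⊤*L  : ∀ {Γ Δ w} → w ≢ ε →
         substΓ ε w Γ ⊢ substΔ ε w Δ → (‵ (w ∶ `⊤*) ∷ Γ) ⊢ Δ
  ∧L   : ∀ {Γ Δ w A B} → (‵ (w ∶ A) ∷ ‵ (w ∶ B) ∷ Γ) ⊢ Δ →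
         (‵ (w ∶ A `∧ B) ∷ Γ) ⊢ Δ
  ∧R   : ∀ {Γ Δ w A B} → Γ ⊢ ((w ∶ A) ∷ Δ) → Γ ⊢ ((w ∶ B) ∷ Δ) →
         Γ ⊢ ((w ∶ A `∧ B) ∷ Δ)
  ⇒L   : ∀ {Γ Δ w A B} → Γ ⊢ ((w ∶ A) ∷ Δ) → (‵ (w ∶ B) ∷ Γ) ⊢ Δ →
         (‵ (w ∶ A `⇒ B) ∷ Γ) ⊢ Δ
  ⇒R   : ∀ {Γ Δ w A B} → (‵ (w ∶ A) ∷ Γ) ⊢ ((w ∶ B) ∷ Δ) →
         Γ ⊢ ((w ∶ A `⇒ B) ∷ Δ)
  *L   : ∀ {Γ Δ z A B} (i j : ℕ) → i ≢ j →
         Fresh (var i) (‵ (z ∶ A `* B) ∷ Γ) Δ →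
         Fresh (var j) (‵ (z ∶ A `* B) ∷ Γ) Δ →
         (⟨ var i , var j ▷ z ⟩ ∷ ‵ (var i ∶ A) ∷ ‵ (var j ∶ B) ∷ Γ) ⊢ Δ →
         (‵ (z ∶ A `* B) ∷ Γ) ⊢ Δ
  -*R  : ∀ {Γ Δ y A B} (i k : ℕ) → i ≢ k →
         Fresh (var i) Γ ((y ∶ A `-* B) ∷ Δ) →
         Fresh (var k) Γ ((y ∶ A `-* B) ∷ Δ) →
         (⟨ var i , y ▷ var k ⟩ ∷ ‵ (var i ∶ A) ∷ Γ) ⊢ ((var k ∶ B) ∷ Δ) →
         Γ ⊢ ((y ∶ A `-* B) ∷ Δ)
  *R   : ∀ {Γ Δ x y z A B} →
         (⟨ x , y ▷ z ⟩ ∷ Γ) ⊢ ((x ∶ A) ∷ (z ∶ A `* B) ∷ Δ) →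
         (⟨ x , y ▷ z ⟩ ∷ Γ) ⊢ ((y ∶ B) ∷ (z ∶ A `* B) ∷ Δ) →
         (⟨ x , y ▷ z ⟩ ∷ Γ) ⊢ ((z ∶ A `* B) ∷ Δ)
  -*L  : ∀ {Γ Δ x y z A B} →
         (⟨ x , y ▷ z ⟩ ∷ ‵ (y ∶ A `-* B) ∷ Γ) ⊢ ((x ∶ A) ∷ Δ) →
         (⟨ x , y ▷ z ⟩ ∷ ‵ (y ∶ A `-* B) ∷ ‵ (z ∶ B) ∷ Γ) ⊢ Δ →
         (⟨ x , y ▷ z ⟩ ∷ ‵ (y ∶ A `-* B) ∷ Γ) ⊢ Δ
  E    : ∀ {Γ Δ x y z} →
         (⟨ y , x ▷ z ⟩ ∷ ⟨ x , y ▷ z ⟩ ∷ Γ) ⊢ Δ →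
         (⟨ x , y ▷ z ⟩ ∷ Γ) ⊢ Δ
  U    : ∀ {Γ Δ x} → (⟨ x , ε ▷ x ⟩ ∷ Γ) ⊢ Δ → Γ ⊢ Δ
  Ass  : ∀ {Γ Δ x y z u v} (k : ℕ) →
         Fresh (var k) (⟨ x , y ▷ z ⟩ ∷ ⟨ u , v ▷ x ⟩ ∷ Γ) Δ →
         (⟨ u , var k ▷ z ⟩ ∷ ⟨ y , v ▷ var k ⟩ ∷ ⟨ x , y ▷ z ⟩ ∷ ⟨ u , v ▷ x ⟩ ∷ Γ) ⊢ Δ →
         (⟨ x , y ▷ z ⟩ ∷ ⟨ u , v ▷ x ⟩ ∷ Γ) ⊢ Δ
  AssC : ∀ {Γ Δ x y} (k : ℕ) →
         Fresh (var k) (⟨ x , y ▷ x ⟩ ∷ Γ) Δ →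
         (⟨ x , var k ▷ x ⟩ ∷ ⟨ y , y ▷ var k ⟩ ∷ ⟨ x , y ▷ x ⟩ ∷ Γ) ⊢ Δ →
         (⟨ x , y ▷ x ⟩ ∷ Γ) ⊢ Δ
  Eq₁  : ∀ {Γ Δ w w'} → w ≢ ε →
         (⟨ ε , w' ▷ w' ⟩ ∷ substΓ w' w Γ) ⊢ substΔ w' w Δ →
         (⟨ ε , w ▷ w' ⟩ ∷ Γ) ⊢ Δ
  Eq₂  : ∀ {Γ Δ w w'} → w ≢ ε →
         (⟨ ε , w' ▷ w' ⟩ ∷ substΓ w' w Γ) ⊢ substΔ w' w Δ →
         (⟨ ε , w' ▷ w ⟩ ∷ Γ) ⊢ Δ
  perm : ∀ {Γ Γ' Δ Δ'} → Γ ↭ Γ' → Δ ↭ Δ' → Γ ⊢ Δ → Γ' ⊢ Δ'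

record Frame (ℓ : Level) : Set (lsuc ℓ) where
  field
    M      : Set ℓ
    _,_▷_  : M → M → M → Set ℓ
    e      : M
    unit→  : ∀ a b → e , a ▷ b → a ≡ b
    unit←  : ∀ a b → a ≡ b → e , a ▷ b
    comm→  : ∀ a b c → a , b ▷ c → b , a ▷ c
    comm←  : ∀ a b c → b , a ▷ c → a , b ▷ c
    assoc  : ∀ a b c d k → a , k ▷ d → b , c ▷ k →
             Σ M (λ l → (a , b ▷ l) × (l , c ▷ d))

module _ {ℓ : Level} (F : Frame ℓ) (v : ℕ → Frame.M F → Set ℓ) where
  open Frame F

  _⊩_ : M → Formula → Set ℓ
  m ⊩ atom p  = v p m
  m ⊩ `⊤      = Lift ℓ ⊤
  m ⊩ `⊥      = Lift ℓ ⊥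
  m ⊩ `⊤*     = m ≡ e
  m ⊩ (A `∧ B)  = (m ⊩ A) × (m ⊩ B)
  m ⊩ (A `⇒ B)  = m ⊩ A → m ⊩ B
  m ⊩ (A `* B)  = Σ M (λ a → Σ M (λ b → (a , b ▷ m) × (a ⊩ A) × (b ⊩ B)))
  m ⊩ (A `-* B) = ∀ a b → m , a ▷ b → a ⊩ A → b ⊩ B

  module _ (ρ : Label → M) where
    HoldsLF : LFormula → Set ℓ
    HoldsLF (w ∶ A) = ρ w ⊩ A

    HoldsI : Item → Set ℓ
    HoldsI (‵ φ) = HoldsLF φ
    HoldsI ⟨ x , y ▷ z ⟩ = ρ x , ρ y ▷ ρ z

Valid : (ℓ : Level) → List Item → List LFormula → Set (lsuc ℓ)
Valid ℓ Γ Δ =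
  (F : Frame ℓ) (v : ℕ → Frame.M F → Set ℓ) (ρ : Label → Frame.M F) →
  ρ ε ≡ Frame.e F →
  All (HoldsI F v ρ) Γ → Any (HoldsLF F v ρ) Δ

-- The structural rules E, U, A, A_C, Eq₁, Eq₂
-- are the frame axioms (commutativity, unit, associativity) read at the level
-- of labels.  The truth of a sequent depends only on the labels occurring in
-- it, so an eigenlabel of *L, -*R, A or A_C may be interpreted as the world
-- whose existence the forcing clause or the frame provides; and the label
-- substitutions of ⊤*L, Eq₁, Eq₂ are sound because they identify labels that
-- denote the same world.  Sequents have several conclusions, so →R and -*R
-- need excluded middle: either the side formulae Δ already hold, or the
-- principal formula must be shown to.

module Submission where

open import Defs
open import Level using (Level; lift)
open import Axiom.ExcludedMiddle using (ExcludedMiddle)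
open import Data.Nat using (ℕ)
open import Data.Nat.Properties using () renaming (_≟_ to _≟ℕ_)
open import Data.Product using (Σ; _×_; _,_)
open import Data.List using (List; _∷_; concatMap)
open import Data.List.Membership.Propositional using (_∈_; _∉_)
open import Data.List.Membership.Propositional.Properties using (∈-++⁺ˡ; ∈-++⁺ʳ)
open import Data.List.Relation.Unary.All as All using (All; []; _∷_)
open import Data.List.Relation.Unary.Any as Any using (Any; here; there)
import Data.List.Relation.Unary.All.Properties as All
import Data.List.Relation.Unary.Any.Properties as Any
open import Data.List.Relation.Binary.Permutation.Propositional using (↭-sym)
open import Data.List.Relation.Binary.Permutation.Propositional.Properties
  using (All-resp-↭; Any-resp-↭)
open import Data.Empty using (⊥-elim)
open import Function using (_∘_)
open import Relation.Binary.PropositionalEquality using (_≡_; _≢_; refl; sym; trans; subst)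
open import Relation.Nullary using (¬_; yes; no)

var-injective : ∀ {i j} → var i ≡ var j → i ≡ j
var-injective refl = refl

module FrameProperties {ℓ : Level} (F : Frame ℓ) where
  open Frame F

  ▷-resp : ∀ {a a′ b b′ c c′} → a ≡ a′ → b ≡ b′ → c ≡ c′ → a , b ▷ c → a′ , b′ ▷ c′
  ▷-resp refl refl refl r = r

  unitˡ : ∀ {u a} → u ≡ e → u , a ▷ a
  unitˡ refl = unit← _ _ refl

  unitʳ : ∀ {u a} → u ≡ e → a , u ▷ a
  unitʳ u≡e = comm→ _ _ _ (unitˡ u≡e)

  unitˡ⁻ : ∀ {u a b} → u ≡ e → u , a ▷ b → a ≡ b
  unitˡ⁻ refl = unit→ _ _

  reassoc : ∀ {x y z u v} → x , y ▷ z → u , v ▷ x →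
                Σ M λ w → (u , w ▷ z) × (y , v ▷ w)
  reassoc xy▷z uv▷x with assoc _ _ _ _ _ (comm→ _ _ _ xy▷z) (comm→ _ _ _ uv▷x)
  ... | w , yv▷w , wu▷z = w , comm→ _ _ _ wu▷z , yv▷w

module Update {a} {M : Set a} where

  -- ε is never updated, so updates preserve ρ ε ≡ e definitionally.
  _[_↦_] : (Label → M) → ℕ → M → Label → M
  (ρ [ n ↦ m ]) ε = ρ ε
  (ρ [ n ↦ m ]) (var k) with k ≟ℕ n
  ... | yes _ = m
  ... | no  _ = ρ (var k)

  update-≡ : ∀ ρ n {m} → (ρ [ n ↦ m ]) (var n) ≡ m
  update-≡ _ n with n ≟ℕ n
  ... | yes _ = refl
  ... | no n≢n = ⊥-elim (n≢n refl)

  update-≢ : ∀ {ρ n m l} → l ≢ var n → (ρ [ n ↦ m ]) l ≡ ρ l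
  update-≢ {l = ε} _ = refl
  update-≢ {n = n} {l = var k} l≢n with k ≟ℕ n
  ... | yes refl = ⊥-elim (l≢n refl)
  ... | no _ = refl

  update-fresh : ∀ {ρ n m l L} → var n ∉ L → l ∈ L → (ρ [ n ↦ m ]) l ≡ ρ l
  update-fresh {L = L} n∉L l∈L = update-≢ λ l≡n → n∉L (subst (_∈ L) l≡n l∈L)

fresh-ante : ∀ {l} Γ Δ → Fresh l Γ Δ → l ∉ concatMap labelsI Γ
fresh-ante _ _ fresh = fresh ∘ ∈-++⁺ˡ

fresh-succ : ∀ {l} Γ Δ → Fresh l Γ Δ → l ∉ concatMap labelsLF Δ
fresh-succ Γ _ fresh = fresh ∘ ∈-++⁺ʳ (concatMap labelsI Γ)

module Interpretation {ℓ : Level} (F : Frame ℓ) (v : ℕ → Frame.M F → Set ℓ) where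
  open Frame F
  open FrameProperties F
  open Update

  Agree : (Label → M) → (Label → M) → List Label → Set ℓ
  Agree ρ ρ′ L = ∀ {l} → l ∈ L → ρ l ≡ ρ′ l

  HoldsLF-agree : ∀ {ρ ρ′} φ → Agree ρ ρ′ (labelsLF φ) →
                  HoldsLF F v ρ φ → HoldsLF F v ρ′ φ
  HoldsLF-agree (w ∶ A) ag = subst (λ m → _⊩_ F v m A) (ag (here refl))

  HoldsI-agree : ∀ {ρ ρ′} it → Agree ρ ρ′ (labelsI it) → HoldsI F v ρ it → HoldsI F v ρ′ it
  HoldsI-agree (‵ φ) ag = HoldsLF-agree φ ag
  HoldsI-agree ⟨ a , b ▷ c ⟩ ag =
    ▷-resp (ag (here refl)) (ag (there (here refl))) (ag (there (there (here refl))))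

  All-agree : ∀ {ρ ρ′} Γ → Agree ρ ρ′ (concatMap labelsI Γ) →
              All (HoldsI F v ρ) Γ → All (HoldsI F v ρ′) Γ
  All-agree (it ∷ Γ) ag (h ∷ hs) =
    HoldsI-agree it (ag ∘ ∈-++⁺ˡ) h ∷ All-agree Γ (ag ∘ ∈-++⁺ʳ (labelsI it)) hs
  All-agree _ _ [] = []

  Any-agree : ∀ {ρ ρ′} Δ → Agree ρ ρ′ (concatMap labelsLF Δ) →
              Any (HoldsLF F v ρ) Δ → Any (HoldsLF F v ρ′) Δ
  Any-agree (φ ∷ Δ) ag (here h) = here (HoldsLF-agree φ (ag ∘ ∈-++⁺ˡ) h)
  Any-agree (φ ∷ Δ) ag (there q) = there (Any-agree Δ (ag ∘ ∈-++⁺ʳ (labelsLF φ)) q)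

  update-All : ∀ {ρ n m Γ} → var n ∉ concatMap labelsI Γ →
               All (HoldsI F v ρ) Γ → All (HoldsI F v (ρ [ n ↦ m ])) Γ
  update-All {Γ = Γ} fresh = All-agree Γ (sym ∘ update-fresh fresh)

  update-Any⁻ : ∀ {ρ n m Δ} → var n ∉ concatMap labelsLF Δ →
                Any (HoldsLF F v (ρ [ n ↦ m ])) Δ → Any (HoldsLF F v ρ) Δ
  update-Any⁻ {Δ = Δ} fresh = Any-agree Δ (update-fresh fresh)

  relabel-≡ : ∀ (ρ : Label → M) {x y} → ρ x ≡ ρ y → ∀ l → ρ (substL y x l) ≡ ρ l
  relabel-≡ ρ {x} ρx≡ρy l with l ≟L x
  ... | yes refl = sym ρx≡ρy
  ... | no  _ = refl

  All-relabel : ∀ {ρ x y Γ} → ρ x ≡ ρ y →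
                All (HoldsI F v ρ) Γ → All (HoldsI F v ρ) (substΓ y x Γ)
  All-relabel {ρ} {x} {y} ρx≡ρy = All.map⁺ ∘ All.map λ {it} → holds it
    where
    holds : ∀ it → HoldsI F v ρ it → HoldsI F v ρ (substI y x it)
    holds (‵ (w ∶ A)) = subst (λ m → _⊩_ F v m A) (sym (relabel-≡ ρ ρx≡ρy w))
    holds ⟨ a , b ▷ c ⟩ =
      ▷-resp (sym (relabel-≡ ρ ρx≡ρy a)) (sym (relabel-≡ ρ ρx≡ρy b)) (sym (relabel-≡ ρ ρx≡ρy c))

  Any-relabel⁻ : ∀ {ρ x y Δ} → ρ x ≡ ρ y →
                 Any (HoldsLF F v ρ) (substΔ y x Δ) → Any (HoldsLF F v ρ) Δ
  Any-relabel⁻ {ρ} {x} {y} ρx≡ρy = Any.map (λ {φ} → holds φ) ∘ Any.map⁻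
    where
    holds : ∀ φ → HoldsLF F v ρ (substLF y x φ) → HoldsLF F v ρ φ
    holds (w ∶ A) = subst (λ m → _⊩_ F v m A) (relabel-≡ ρ ρx≡ρy w)

Any-head : ∀ {a p} {A : Set a} {P : A → Set p} {x xs} → ¬ Any P xs → Any P (x ∷ xs) → P x
Any-head _ (here px) = px
Any-head ¬q (there q) = ⊥-elim (¬q q)

module Classical {p : Level} (em : ExcludedMiddle p) where

  here-unless-there : ∀ {A : Set} {P : A → Set p} {x xs} → (¬ Any P xs → P x) → Any P (x ∷ xs)
  here-unless-there {P = P} {xs = xs} px with em {Any P xs}
  ... | yes q = there q
  ... | no ¬q = here (px ¬q)

module Soundness {ℓ : Level} (em : ExcludedMiddle ℓ)
                 (F : Frame ℓ) (v : ℕ → Frame.M F → Set ℓ) where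
  open Frame F
  open FrameProperties F
  open Update
  open Interpretation F v
  open Classical em

  ValidIn : List Item → List LFormula → Set ℓ
  ValidIn Γ Δ = ∀ ρ → ρ ε ≡ e → All (HoldsI F v ρ) Γ → Any (HoldsLF F v ρ) Δ

  sound : ∀ {Γ Δ} → Γ ⊢ Δ → ValidIn Γ Δ
  sound id ρ ρε (h ∷ _) = here h
  sound ⊥L ρ ρε (lift () ∷ _)
  sound ⊤R ρ ρε _ = here (lift _)
  sound ⊤*R ρ ρε _ = here ρε
  sound (cut {Γ = Γ} {Δ = Δ} d₁ d₂) ρ ρε hs with All.++⁻ Γ hs
  ... | hΓ , hΓ′ with sound d₁ ρ ρε hΓ
  ...   | here hA = Any.++⁺ʳ Δ (sound d₂ ρ ρε (hA ∷ hΓ′))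
  ...   | there q = Any.++⁺ˡ q
  sound (⊤*L _ d) ρ ρε (ρw≡e ∷ hs) = Any-relabel⁻ ρw≡ρε (sound d ρ ρε (All-relabel ρw≡ρε hs))
    where ρw≡ρε = trans ρw≡e (sym ρε)
  sound (∧L d) ρ ρε ((hA , hB) ∷ hs) = sound d ρ ρε (hA ∷ hB ∷ hs)
  sound (∧R d₁ d₂) ρ ρε hs with sound d₁ ρ ρε hs | sound d₂ ρ ρε hs
  ... | here hA | here hB = here (hA , hB)
  ... | there q | _ = there q
  ... | _ | there q = there q
  sound (⇒L d₁ d₂) ρ ρε (h ∷ hs) with sound d₁ ρ ρε hs
  ... | here hA = sound d₂ ρ ρε (h hA ∷ hs)
  ... | there q = q
  sound (⇒R d) ρ ρε hs = here-unless-there λ ¬q hA → Any-head ¬q (sound d ρ ρε (hA ∷ hs))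
  sound (*L {Γ} {Δ} {z} {A} {B} i j i≢j fresh-i fresh-j d) ρ ρε hs@((a , b , ab▷z , hA , hB) ∷ _) =
    update-Any⁻ (fresh-succ Γ′ Δ fresh-i) (update-Any⁻ (fresh-succ Γ′ Δ fresh-j) (sound d ρ₂ ρε
      (▷-resp (sym ρ₂i) (sym ρ₂j) (sym ρ₂z) ab▷z
       ∷ subst (λ m → _⊩_ F v m A) (sym ρ₂i) hA
       ∷ subst (λ m → _⊩_ F v m B) (sym ρ₂j) hB
       ∷ All.tail (update-All (fresh-ante Γ′ Δ fresh-j) (update-All (fresh-ante Γ′ Δ fresh-i) hs)))))
    where
    Γ′ = ‵ (z ∶ A `* B) ∷ Γ
    ρ₁ = ρ [ i ↦ a ]
    ρ₂ = ρ₁ [ j ↦ b ]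
    ρ₂i : ρ₂ (var i) ≡ a
    ρ₂i = trans (update-≢ (i≢j ∘ var-injective)) (update-≡ ρ i)
    ρ₂j : ρ₂ (var j) ≡ b
    ρ₂j = update-≡ ρ₁ j
    ρ₂z : ρ₂ z ≡ ρ z
    ρ₂z = trans (update-fresh fresh-j (here refl)) (update-fresh fresh-i (here refl))
  sound (-*R {Γ} {Δ} {y} {A} {B} i k i≢k fresh-i fresh-k d) ρ ρε hs = here-unless-there wand
    where
    wand : ¬ Any (HoldsLF F v ρ) Δ → ∀ a b → ρ y , a ▷ b → _⊩_ F v a A → _⊩_ F v b B
    wand ¬q a b ya▷b hA =
      subst (λ m → _⊩_ F v m B) ρ₂k
        (Any-head (¬q ∘ update-Any⁻ (fresh-succ Γ Δ′ fresh-i ∘ there)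
                     ∘ update-Any⁻ (fresh-succ Γ Δ′ fresh-k ∘ there))
          (sound d ρ₂ ρε (▷-resp (sym ρ₂i) (sym ρ₂y) (sym ρ₂k) (comm→ _ _ _ ya▷b)
                          ∷ subst (λ m → _⊩_ F v m A) (sym ρ₂i) hA
                          ∷ update-All (fresh-ante Γ Δ′ fresh-k) (update-All (fresh-ante Γ Δ′ fresh-i) hs))))
      where
      Δ′ = (y ∶ A `-* B) ∷ Δ
      ρ₁ = ρ [ i ↦ a ]
      ρ₂ = ρ₁ [ k ↦ b ]
      ρ₂i : ρ₂ (var i) ≡ a
      ρ₂i = trans (update-≢ (i≢k ∘ var-injective)) (update-≡ ρ i)
      ρ₂k : ρ₂ (var k) ≡ b
      ρ₂k = update-≡ ρ₁ k
      ρ₂y : ρ₂ y ≡ ρ y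
      ρ₂y = trans (update-fresh (fresh-succ Γ Δ′ fresh-k) (here refl))
                  (update-fresh (fresh-succ Γ Δ′ fresh-i) (here refl))
  sound (*R {x = x} {y = y} d₁ d₂) ρ ρε hs with sound d₁ ρ ρε hs | sound d₂ ρ ρε hs
  ... | here hA | here hB = here (ρ x , ρ y , All.head hs , hA , hB)
  ... | there q | _ = q
  ... | _ | there q = q
  sound (-*L d₁ d₂) ρ ρε hs@(xy▷z ∷ hw ∷ hs′) with sound d₁ ρ ρε hs
  ... | here hA = sound d₂ ρ ρε (xy▷z ∷ hw ∷ hw _ _ (comm→ _ _ _ xy▷z) hA ∷ hs′)
  ... | there q = q
  sound (E d) ρ ρε (r ∷ hs) = sound d ρ ρε (comm→ _ _ _ r ∷ r ∷ hs)
  sound (U d) ρ ρε hs = sound d ρ ρε (unitʳ ρε ∷ hs)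
  sound (Ass {Γ} {Δ} {x} {y} {z} {u} {v′} k fresh d) ρ ρε hs@(xy▷z ∷ uv▷x ∷ _)
    with reassoc xy▷z uv▷x
  ... | w , uw▷z , yv▷w =
    update-Any⁻ (fresh-succ Γ′ Δ fresh) (sound d ρ′ ρε
      (▷-resp (kept u∈) (sym ρ′k) (kept z∈) uw▷z
       ∷ ▷-resp (kept y∈) (kept v∈) (sym ρ′k) yv▷w
       ∷ update-All (fresh-ante Γ′ Δ fresh) hs))
    where
    Γ′ = ⟨ x , y ▷ z ⟩ ∷ ⟨ u , v′ ▷ x ⟩ ∷ Γ
    ρ′ = ρ [ k ↦ w ]
    ρ′k : ρ′ (var k) ≡ w
    ρ′k = update-≡ ρ k
    kept : ∀ {l} → l ∈ labels Γ′ Δ → ρ l ≡ ρ′ l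
    kept = sym ∘ update-fresh fresh
    y∈ : y ∈ labels Γ′ Δ
    y∈ = there (here refl)
    z∈ : z ∈ labels Γ′ Δ
    z∈ = there (there (here refl))
    u∈ : u ∈ labels Γ′ Δ
    u∈ = there (there (there (here refl)))
    v∈ : v′ ∈ labels Γ′ Δ
    v∈ = there (there (there (there (here refl))))
  sound (AssC {Γ} {Δ} {x} {y} k fresh d) ρ ρε hs@(xy▷x ∷ _) with reassoc xy▷x xy▷x
  ... | w , xw▷x , yy▷w =
    update-Any⁻ (fresh-succ Γ′ Δ fresh) (sound d ρ′ ρε
      (▷-resp (kept x∈) (sym ρ′k) (kept x∈) xw▷x
       ∷ ▷-resp (kept y∈) (kept y∈) (sym ρ′k) yy▷w
       ∷ update-All (fresh-ante Γ′ Δ fresh) hs))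
    where
    Γ′ = ⟨ x , y ▷ x ⟩ ∷ Γ
    ρ′ = ρ [ k ↦ w ]
    ρ′k : ρ′ (var k) ≡ w
    ρ′k = update-≡ ρ k
    kept : ∀ {l} → l ∈ labels Γ′ Δ → ρ l ≡ ρ′ l
    kept = sym ∘ update-fresh fresh
    x∈ : x ∈ labels Γ′ Δ
    x∈ = here refl
    y∈ : y ∈ labels Γ′ Δ
    y∈ = there (here refl)
  sound (Eq₁ _ d) ρ ρε (εw▷w′ ∷ hs) =
    Any-relabel⁻ ρw≡ρw′ (sound d ρ ρε (unitˡ ρε ∷ All-relabel ρw≡ρw′ hs))
    where ρw≡ρw′ = unitˡ⁻ ρε εw▷w′
  sound (Eq₂ _ d) ρ ρε (εw′▷w ∷ hs) =
    Any-relabel⁻ ρw≡ρw′ (sound d ρ ρε (unitˡ ρε ∷ All-relabel ρw≡ρw′ hs))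
    where ρw≡ρw′ = sym (unitˡ⁻ ρε εw′▷w)
  sound (perm Γ↭Γ′ Δ↭Δ′ d) ρ ρε hs =
    Any-resp-↭ Δ↭Δ′ (sound d ρ ρε (All-resp-↭ (↭-sym Γ↭Γ′) hs))

theorem1 : ∀ {ℓ : Level} → ExcludedMiddle ℓ →
           ∀ {Γ Δ} → Γ ⊢ Δ → Valid ℓ Γ Δ
theorem1 em d F v = Soundness.sound em F v d
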